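{- Let $G=(V,E)$ be a connected Eulerian digraph and $s\in V$, and consider the chip-firing game on $G$ with sink $s$. Let $c$ be a minimal recurrent configuration and $\mathcal{F}=(V,\mathcal{E})$ a firing graph of $c$. Then $c(v)=\mathrm{outdeg}_G(v)-\mathrm{indeg}_{\mathcal{F}}(v)$ for every $v\in V\setminus\{s\}$, $\mathcal{E}$ is a maximal acyclic arc set of $G$ in which $s$ is the unique vertex of in-degree $0$, and the total number of chips of $c$ is $|E|-\mathrm{outdeg}_G(s)-|\mathcal{E}|$.
   Context: Digraphs are finite and simple; Eulerian means in-degree equals out-degree at every vertex. An acyclic arc set of $G$ is $A\subseteq E$ such that $(V,A)$ has no directed cycle; it is maximal if adding any arc of $E\setminus A$ creates a directed cycle. Chip-firing on $G$ with sink $s$ (i.e. on $G$ with all arcs of tail $s$ deleted): a configuration is a map $c:V\setminus\{s\}\to\mathbb{N}$. A vertex $v\neq s$ is active if $c(v)\ge\mathrm{outdeg}_G(v)\ge1$; firing $v$ subtracts $\mathrm{outdeg}_G(v)$ from $c(v)$ and adds one chip to each out-neighbour $w\ne s$ of $v$ (chips sent to $s$ vanish). Legal firing = firing an active vertex; $c\to^*d$ means reachable by legal firings; $c$ stable if no vertex is active; $c^\circ$ is the unique stable configuration reached from $c$. $c$ is accessible if for every configuration $d$ there is $d'$ with $d+d'\to^*c$; recurrent if stable and accessible. $c'\le c$ is componentwise; a recurrent $c$ is minimal if no recurrent $c'\ne c$ has $c'\le c$. The total number of chips of $c$ is $\sum_{v\ne s}c(v)$. Let $\beta(v)=1$ if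 $(s,v)\in E$ and $0$ otherwise. It is known that for recurrent $c$, $(c+\beta)^\circ=c$ and every legal firing sequence from $c+\beta$ to $c$ fires each vertex of $V\setminus\{s\}$ exactly once. A firing graph of a recurrent $c$: for a legal firing sequence $(w_1,\dots,w_k)$ from $c+\beta$ ending at $c$, the digraph with vertex set $V$ and arc set $\{(s,w_i):(s,w_i)\in E\}\cup\{(w_i,w_j):i<j,(w_i,w_j)\in E\}$. -}

module Defs where

open import Data.Nat using (ℕ; zero; suc; _+_; _∸_; _≤_)
open import Data.Bool using (Bool; true; false; _∧_; _∨_; if_then_else_; not)
open import Data.Fin using (Fin; _≟_)
open import Data.List using (List; []; _∷_; map; allFin)
open import Data.Nat.ListAction using (sum)
open import Data.List.Relation.Unary.Unique.Propositional using (Unique)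
open import Data.Product using (Σ; ∃; _×_; _,_)
open import Data.Sum using (_⊎_)
open import Data.Empty using (⊥)
open import Relation.Nullary using (¬_)
open import Relation.Nullary.Decidable using (⌊_⌋)
open import Relation.Binary.PropositionalEquality using (_≡_; _≢_)
open import Relation.Binary.Construct.Closure.ReflexiveTransitive using (Star)

-- Finite simple digraphs on vertex set Fin n.
-- Arcs are given by a Boolean adjacency relation (so no multiple arcs),
-- and there are no loops.

record Digraph (n : ℕ) : Set where
  field
    arc      : Fin n → Fin n → Bool
    loopless : ∀ v → arc v v ≡ false
open Digraph public

ArcSet : ℕ → Set
ArcSet n = Fin n → Fin n → Bool

b2n : Bool → ℕ
b2n true  = 1
b2n false = 0

sumV : ∀ {n} → (Fin n → ℕ) → ℕ
sumV {n} f = sum (map f (allFin n))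

outdegA : ∀ {n} → ArcSet n → Fin n → ℕ
outdegA A v = sumV (λ w → b2n (A v w))

indegA : ∀ {n} → ArcSet n → Fin n → ℕ
indegA A v = sumV (λ u → b2n (A u v))

sizeA : ∀ {n} → ArcSet n → ℕ
sizeA A = sumV (λ u → outdegA A u)

outdeg : ∀ {n} → Digraph n → Fin n → ℕ
outdeg G = outdegA (arc G)

indeg : ∀ {n} → Digraph n → Fin n → ℕ
indeg G = indegA (arc G)

Eulerian : ∀ {n} → Digraph n → Set
Eulerian G = ∀ v → indeg G v ≡ outdeg G v

UAdj : ∀ {n} → Digraph n → Fin n → Fin n → Set
UAdj G x y = (arc G x y ≡ true) ⊎ (arc G y x ≡ true)

Connected : ∀ {n} → Digraph n → Set
Connected G = ∀ x y → Star (UAdj G) x y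

WalkFrom : ∀ {n} → ArcSet n → Fin n → List (Fin n) → Fin n → Set
WalkFrom A u []       t = A u t ≡ true
WalkFrom A u (y ∷ ys) t = (A u y ≡ true) × WalkFrom A y ys t

IsCycle : ∀ {n} → ArcSet n → List (Fin n) → Set
IsCycle A []       = ⊥
IsCycle A (x ∷ xs) = Unique (x ∷ xs) × WalkFrom A x xs x

HasCycle : ∀ {n} → ArcSet n → Set
HasCycle {n} A = Σ (List (Fin n)) (IsCycle A)

SubsetOf : ∀ {n} → ArcSet n → Digraph n → Set
SubsetOf A G = ∀ x y → A x y ≡ true → arc G x y ≡ true

AcyclicArcSet : ∀ {n} → Digraph n → ArcSet n → Set
AcyclicArcSet G A = SubsetOf A G × ¬ HasCycle A

addArc : ∀ {n} → ArcSet n → Fin n → Fin n → ArcSet n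
addArc A x y u v = A u v ∨ (⌊ u ≟ x ⌋ ∧ ⌊ v ≟ y ⌋)

MaximalAcyclicArcSet : ∀ {n} → Digraph n → ArcSet n → Set
MaximalAcyclicArcSet G A =
  AcyclicArcSet G A ×
  (∀ x y → arc G x y ≡ true → A x y ≡ false → HasCycle (addArc A x y))

-- A configuration is represented by a map Fin n → ℕ; its value at the
-- sink s is irrelevant: every notion below only inspects values at
-- vertices v ≢ s (equality and order are taken pointwise off s).

Config : ℕ → Set
Config n = Fin n → ℕ

module ChipFiring {n : ℕ} (G : Digraph n) (s : Fin n) where

  _≈_ : Config n → Config n → Set
  c ≈ d = ∀ v → v ≢ s → c v ≡ d v

  _≼_ : Config n → Config n → Set
  c ≼ d = ∀ v → v ≢ s → c v ≤ d v

  _⊕_ : Config n → Config n → Config n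
  (c ⊕ d) v = c v + d v

  Active : Config n → Fin n → Set
  Active c v = v ≢ s × 1 ≤ outdeg G v × outdeg G v ≤ c v

  -- firing v: subtract outdeg v at v, add one chip to each out-neighbour
  -- (a chip "sent" to the sink is irrelevant since the value at s is ignored)
  fire : Config n → Fin n → Config n
  fire c v w = (if ⌊ w ≟ v ⌋ then c w ∸ outdeg G v else c w) + b2n (arc G v w)

  fireSeq : Config n → List (Fin n) → Config n
  fireSeq c []       = c
  fireSeq c (v ∷ vs) = fireSeq (fire c v) vs

  Legal : Config n → List (Fin n) → Set
  Legal c []       = Data.Unit.⊤ where import Data.Unit
  Legal c (v ∷ vs) = Active c v × Legal (fire c v) vs

  _⟶*_ : Config n → Config n → Set
  c ⟶* d = Σ (List (Fin n)) λ ws → Legal c ws × fireSeq c ws ≈ d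

  Stable : Config n → Set
  Stable c = ∀ v → ¬ Active c v

  Accessible : Config n → Set
  Accessible c = ∀ d → ∃ λ d' → (d ⊕ d') ⟶* c

  Recurrent : Config n → Set
  Recurrent c = Stable c × Accessible c

  MinimalRecurrent : Config n → Set
  MinimalRecurrent c = Recurrent c × (∀ c' → Recurrent c' → c' ≼ c → c' ≈ c)

  β : Config n
  β v = b2n (arc G s v)

  totalChips : Config n → ℕ
  totalChips c = sumV (λ v → if ⌊ v ≟ s ⌋ then 0 else c v)

  elem : Fin n → List (Fin n) → Bool
  elem x []       = false
  elem x (y ∷ ys) = ⌊ x ≟ y ⌋ ∨ elem x ys

  before : List (Fin n) → Fin n → Fin n → Bool
  before []       x y = false
  before (w ∷ ws) x y = (⌊ w ≟ x ⌋ ∧ elem y ws) ∨ before ws x y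

  -- arc set of the firing graph associated to the firing sequence ws:
  -- {(s,wᵢ) ∈ E} ∪ {(wᵢ,wⱼ) ∈ E : i < j}
  firingArcs : List (Fin n) → ArcSet n
  firingArcs ws x y = arc G x y ∧ ((⌊ x ≟ s ⌋ ∧ elem y ws) ∨ before ws x y)

  FiringSeqOf : Config n → List (Fin n) → Set
  FiringSeqOf c ws = Legal (c ⊕ β) ws × fireSeq (c ⊕ β) ws ≈ c

module Submission where

-- Stabilising c + β fires every non-sink vertex exactly once (a vertex receives at most
-- indeg = outdeg chips, and the unfired vertices would form an in- and hence out-closed set),
-- and v fires holding c v + β v + (arcs into v from earlier vertices) ≥ outdeg v chips, the last two
-- terms being indeg_F v. By the burning criterion any r ≤ c meeting these thresholds for some
-- firing order is recurrent, hence equal to c. Slack at v would let us remove a chip at v, forcing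
-- c v = 0 and indeg_F v > outdeg v; so c v + indeg_F v = outdeg v. F is acyclic since positions in
-- the firing order increase along its arcs. For an arc x → y of G outside F, firing the F-descendants
-- of y last would create slack at y unless x is such a descendant, in which case x → y closes a
-- cycle. The chip count follows by summing the degree identity.

open import Data.Nat using (ℕ; zero; suc; _+_; _∸_; _≤_; _<_; _≤?_; z≤n; s≤s)
open import Data.Nat.Properties hiding (suc-injective; _≟_)
open import Data.Nat.ListAction using (sum)
open import Data.Bool.Properties using (∨-assoc; ∨-identityʳ; ∧-identityʳ; ∧-zeroʳ)
open import Data.Bool using (Bool; true; false; _∧_; _∨_; if_then_else_; not)
open import Data.Fin using (Fin; zero; suc; _≟_)
open import Data.Fin.Properties using (suc-injective)
open import Data.List using (List; []; _∷_; map; tabulate; _++_; length)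
open import Data.List.Properties using (++-assoc; ++-identityʳ)
open import Data.List.Relation.Unary.All as All using (All; []; _∷_)
import Data.List.Relation.Unary.All.Properties as Allₚ
open import Data.List.Relation.Unary.AllPairs using ([]; _∷_)
open import Data.List.Relation.Unary.Unique.Propositional using (Unique)
open import Data.Product using (∃; _×_; _,_; proj₁; proj₂)
open import Data.Sum using (_⊎_; inj₁; inj₂)
open import Data.Empty using (⊥-elim)
open import Function using (_∘_; id)
open import Relation.Nullary using (¬_; Dec; yes; no)
open import Relation.Nullary.Decidable using (⌊_⌋)
open import Relation.Binary.PropositionalEquality
open import Algebra.Properties.CommutativeMonoid.Sum +-0-commutativeMonoid
  using (∑-distrib-+; ∑-comm; sum-cong-≗; sum-replicate-zero) renaming (sum to ∑)
open import Algebra.Properties.CommutativeSemigroup +-commutativeSemigroup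
  using (x∙yz≈xz∙y; xy∙z≈xz∙y)
open import Data.Nat.Tactic.RingSolver using (solve-∀)
open import Relation.Binary.Construct.Closure.ReflexiveTransitive using (Star; ε; _◅_)
open import Defs

sumV≡∑ : ∀ {n} (f : Fin n → ℕ) → sumV f ≡ ∑ f
sumV≡∑ {n} f = go n id
  where
  go : ∀ m (g : Fin m → Fin n) → sum (map f (tabulate g)) ≡ ∑ (f ∘ g)
  go zero    g = refl
  go (suc m) g = cong (f (g zero) +_) (go m (g ∘ suc))

∑-zero : ∀ {n} {f : Fin n → ℕ} → (∀ u → f u ≡ 0) → ∑ f ≡ 0
∑-zero {n} h = trans (sum-cong-≗ h) (sum-replicate-zero n)

∑≡0⇒≡0 : ∀ {n} (f : Fin n → ℕ) → ∑ f ≡ 0 → ∀ u → f u ≡ 0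
∑≡0⇒≡0 f e zero    = m+n≡0⇒m≡0 (f zero) e
∑≡0⇒≡0 f e (suc u) = ∑≡0⇒≡0 (f ∘ suc) (m+n≡0⇒n≡0 (f zero) e) u

∑>0⇒∃ : ∀ {n} (f : Fin n → ℕ) → 0 < ∑ f → ∃ λ u → 0 < f u
∑>0⇒∃ {suc n} f p with f zero in eq
... | suc _ = zero , subst (0 <_) (sym eq) (s≤s z≤n)
... | zero  = let u , q = ∑>0⇒∃ (f ∘ suc) p in suc u , q

≤∑ : ∀ {n} (f : Fin n → ℕ) x → f x ≤ ∑ f
≤∑ f zero    = m≤m+n _ _
≤∑ f (suc x) = ≤-trans (≤∑ (f ∘ suc) x) (m≤n+m _ _)

∑-mono-≤ : ∀ {n} {f g : Fin n → ℕ} → (∀ u → f u ≤ g u) → ∑ f ≤ ∑ g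
∑-mono-≤ {zero}  h = z≤n
∑-mono-≤ {suc n} h = +-mono-≤ (h zero) (∑-mono-≤ (h ∘ suc))

∑-mono-< : ∀ {n} {f g : Fin n → ℕ} x → (∀ u → f u ≤ g u) → f x < g x → ∑ f < ∑ g
∑-mono-< zero    h lt = +-mono-<-≤ lt (∑-mono-≤ (h ∘ suc))
∑-mono-< (suc x) h lt = +-mono-≤-< (h zero) (∑-mono-< x (h ∘ suc) lt)

∑-pointed : ∀ {n} (f : Fin n → ℕ) x → (∀ u → u ≢ x → f u ≡ 0) → ∑ f ≡ f x
∑-pointed f zero    h = trans (cong (f zero +_) (∑-zero (λ u → h (suc u) λ ()))) (+-identityʳ _)
∑-pointed f (suc x) h =
  trans (cong (_+ ∑ (f ∘ suc)) (h zero λ ()))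
        (∑-pointed (f ∘ suc) x (λ u u≢x → h (suc u) (u≢x ∘ suc-injective)))

∑-if : ∀ {n} b (f : Fin n → ℕ) → (if b then ∑ f else 0) ≡ ∑ (λ x → if b then f x else 0)
∑-if     true  f = refl
∑-if {n} false f = sym (∑-zero {n} λ _ → refl)

≟-refl : ∀ {n} (x : Fin n) → ⌊ x ≟ x ⌋ ≡ true
≟-refl x with x ≟ x
... | yes _   = refl
... | no x≢x  = ⊥-elim (x≢x refl)

≟-≢ : ∀ {n} {x y : Fin n} → x ≢ y → ⌊ x ≟ y ⌋ ≡ false
≟-≢ {x = x} {y} x≢y with x ≟ y
... | yes x≡y = ⊥-elim (x≢y x≡y)
... | no _    = refl

≟-sound : ∀ {n} {x y : Fin n} → ⌊ x ≟ y ⌋ ≡ true → x ≡ y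
≟-sound {x = x} {y} e with x ≟ y
... | yes x≡y = x≡y

≟-sym : ∀ {n} (x y : Fin n) → ⌊ x ≟ y ⌋ ≡ ⌊ y ≟ x ⌋
≟-sym x y with x ≟ y | y ≟ x
... | yes _   | yes _   = refl
... | no _    | no _    = refl
... | yes x≡y | no y≢x  = ⊥-elim (y≢x (sym x≡y))
... | no x≢y  | yes y≡x = ⊥-elim (x≢y (sym y≡x))

true≢false : true ≢ false
true≢false ()

∨-introˡ : ∀ {a b} → a ≡ true → a ∨ b ≡ true
∨-introˡ refl = refl

∨-introʳ : ∀ a {b} → b ≡ true → a ∨ b ≡ true
∨-introʳ true  _ = refl
∨-introʳ false e = e

∨-elim : ∀ a {b} → a ∨ b ≡ true → a ≡ true ⊎ b ≡ true
∨-elim true  _ = inj₁ refl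
∨-elim false e = inj₂ e

∧-elim : ∀ a {b} → a ∧ b ≡ true → a ≡ true × b ≡ true
∧-elim true e = refl , e

∧-intro : ∀ {a b} → a ≡ true → b ≡ true → a ∧ b ≡ true
∧-intro refl refl = refl

except : ∀ {n} → Fin n → (Fin n → ℕ) → Fin n → ℕ
except s g v = if ⌊ v ≟ s ⌋ then 0 else g v

∑-except : ∀ {n} (g : Fin n → ℕ) s → ∑ g ≡ g s + ∑ (except s g)
∑-except {n} g s = begin
  ∑ g                                                ≡⟨ sum-cong-≗ split ⟩
  ∑ (λ u → at u + except s g u)                      ≡⟨ ∑-distrib-+ at (except s g) ⟩
  ∑ at + ∑ (except s g)                              ≡⟨ cong (_+ ∑ (except s g)) (∑-pointed at s at-off) ⟩
  at s + ∑ (except s g)                              ≡⟨ cong (λ b → (if b then g s else 0) + ∑ (except s g)) (≟-refl s) ⟩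
  g s + ∑ (except s g)                               ∎
  where
  open ≡-Reasoning
  at : Fin n → ℕ
  at u = if ⌊ u ≟ s ⌋ then g u else 0
  split : ∀ u → g u ≡ at u + except s g u
  split u with u ≟ s
  ... | yes _ = sym (+-identityʳ _)
  ... | no _  = refl
  at-off : ∀ u → u ≢ s → at u ≡ 0
  at-off u u≢s rewrite ≟-≢ u≢s = refl

prefix-induction : ∀ {A : Set} (L : List A) (Q : List A → Set) → Q [] →
  (∀ P v post → P ++ v ∷ post ≡ L → Q P → Q (P ++ v ∷ [])) → Q L
prefix-induction {A} L Q q[] step = go L [] refl q[]
  where
  go : ∀ post P → P ++ post ≡ L → Q P → Q L
  go []         P eq q = subst Q (trans (sym (++-identityʳ P)) eq) q
  go (v ∷ post) P eq q =
    go post (P ++ v ∷ []) (trans (++-assoc P (v ∷ []) post) eq) (step P v post eq q)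

Unique-++⁻ˡ : ∀ {A : Set} (P Q : List A) → Unique (P ++ Q) → Unique P
Unique-++⁻ˡ []      Q _          = []
Unique-++⁻ˡ (x ∷ P) Q (x∉ ∷ uPQ) = Allₚ.++⁻ˡ P x∉ ∷ Unique-++⁻ˡ P Q uPQ

bfilter : ∀ {A : Set} → (A → Bool) → List A → List A
bfilter p []      = []
bfilter p (w ∷ L) = if p w then w ∷ bfilter p L else bfilter p L

All-bfilter : ∀ {A : Set} {P : A → Set} (p : A → Bool) L → All P L → All P (bfilter p L)
All-bfilter p []      []         = []
All-bfilter p (w ∷ L) (pw ∷ pL) with p w
... | true  = pw ∷ All-bfilter p L pL
... | false = All-bfilter p L pL

Unique-bfilter : ∀ {A : Set} (p : A → Bool) L → Unique L → Unique (bfilter p L)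
Unique-bfilter p []      []         = []
Unique-bfilter p (w ∷ L) (w∉ ∷ uL) with p w
... | true  = All-bfilter p L w∉ ∷ Unique-bfilter p L uL
... | false = Unique-bfilter p L uL

module Membership {n : ℕ} (G : Digraph n) (s : Fin n) where
  open ChipFiring G s

  elem-++ : ∀ x A B → elem x (A ++ B) ≡ elem x A ∨ elem x B
  elem-++ x []      B = refl
  elem-++ x (a ∷ A) B rewrite elem-++ x A B = sym (∨-assoc ⌊ x ≟ a ⌋ (elem x A) (elem x B))

  elem-here : ∀ x L → elem x (x ∷ L) ≡ true
  elem-here x L rewrite ≟-refl x = refl

  elem-++ʳ : ∀ x A B → elem x B ≡ true → elem x (A ++ B) ≡ true
  elem-++ʳ x A B e rewrite elem-++ x A B = ∨-introʳ (elem x A) e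

  elem-++ˡ : ∀ x A B → elem x A ≡ true → elem x (A ++ B) ≡ true
  elem-++ˡ x A B e rewrite elem-++ x A B = ∨-introˡ e

  All≢⇒elem≡false : ∀ x L → All (x ≢_) L → elem x L ≡ false
  All≢⇒elem≡false x []      []           = refl
  All≢⇒elem≡false x (y ∷ L) (x≢y ∷ x∉L) rewrite ≟-≢ x≢y = All≢⇒elem≡false x L x∉L

  elem≡false⇒All≢ : ∀ x L → elem x L ≡ false → All (x ≢_) L
  elem≡false⇒All≢ x []      _ = []
  elem≡false⇒All≢ x (y ∷ L) e with x ≟ y
  ... | no x≢y = x≢y ∷ elem≡false⇒All≢ x L e

  elem-distinct : ∀ {x y} L → elem x L ≡ false → elem y L ≡ true → x ≢ y
  elem-distinct L x∉ y∈ refl = true≢false (trans (sym y∈) x∉)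

  Unique-++ : ∀ A B → Unique A → Unique B →
    (∀ v → elem v A ≡ true → elem v B ≡ false) → Unique (A ++ B)
  Unique-++ []      B _          uB _ = uB
  Unique-++ (a ∷ A) B (a∉ ∷ uA) uB disjoint =
    Allₚ.++⁺ a∉ (elem≡false⇒All≢ a B (disjoint a (elem-here a A)))
    ∷ Unique-++ A B uA uB (λ v e → disjoint v (∨-introʳ _ e))

  Unique-snoc : ∀ P v → Unique P → elem v P ≡ false → Unique (P ++ v ∷ [])
  Unique-snoc P v uP v∉P = Unique-++ P (v ∷ []) uP ([] ∷ []) v∉
    where
    v∉ : ∀ w → elem w P ≡ true → elem w (v ∷ []) ≡ false
    v∉ w w∈P rewrite ≟-≢ (λ w≡v → elem-distinct P v∉P w∈P (sym w≡v)) = refl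

  Unique⇒∉prefix : ∀ P v post → Unique (P ++ v ∷ post) → elem v P ≡ false
  Unique⇒∉prefix []      v post _ = refl
  Unique⇒∉prefix (w ∷ P) v post (w∉ ∷ u) with Allₚ.++⁻ʳ P w∉
  ... | w≢v ∷ _ rewrite ≟-≢ (w≢v ∘ sym) = Unique⇒∉prefix P v post u

  split-at : ∀ v L → elem v L ≡ true → ∃ λ P → ∃ λ post → P ++ v ∷ post ≡ L
  split-at v (w ∷ L) e with v ≟ w
  ... | yes refl = [] , L , refl
  ... | no _     = let P , post , eq = split-at v L e in w ∷ P , post , cong (w ∷_) eq

  position : Fin n → List (Fin n) → ℕ
  position x []      = 0
  position x (w ∷ L) = if ⌊ x ≟ w ⌋ then 0 else suc (position x L)

  position-there : ∀ {x w} L → x ≢ w → position x (w ∷ L) ≡ suc (position x L)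
  position-there L x≢w rewrite ≟-≢ x≢w = refl

  position<length : ∀ x L → elem x L ≡ true → position x L < length L
  position<length x (w ∷ L) e with x ≟ w
  ... | yes _ = s≤s z≤n
  ... | no _  = s≤s (position<length x L e)

  ∑-elem : ∀ (g : Fin n → ℕ) L → Unique L → ∑ (λ u → if elem u L then g u else 0) ≡ sum (map g L)
  ∑-elem g []      _          = ∑-zero {n} λ _ → refl
  ∑-elem g (x ∷ L) (x∉ ∷ uL) = begin
    ∑ (λ u → if ⌊ u ≟ x ⌋ ∨ elem u L then g u else 0)            ≡⟨ sum-cong-≗ split ⟩
    ∑ (λ u → at u + (if elem u L then g u else 0))                ≡⟨ ∑-distrib-+ at _ ⟩
    ∑ at + ∑ (λ u → if elem u L then g u else 0)                  ≡⟨ cong₂ _+_ ∑at (∑-elem g L uL) ⟩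
    g x + sum (map g L)                                           ∎
    where
    open ≡-Reasoning
    at : Fin n → ℕ
    at u = if ⌊ u ≟ x ⌋ then g u else 0
    split : ∀ u → (if ⌊ u ≟ x ⌋ ∨ elem u L then g u else 0) ≡ at u + (if elem u L then g u else 0)
    split u with u ≟ x
    ... | yes refl rewrite All≢⇒elem≡false x L x∉ = sym (+-identityʳ _)
    ... | no _     = refl
    ∑at : ∑ at ≡ g x
    ∑at = trans (∑-pointed at x (λ u u≢x → cong (λ b → if b then g u else 0) (≟-≢ u≢x)))
                (cong (λ b → if b then g x else 0) (≟-refl x))

  before⇒elem : ∀ L x y → before L x y ≡ true → elem x L ≡ true × elem y L ≡ true
  before⇒elem (w ∷ L) x y e with ∨-elim (⌊ w ≟ x ⌋ ∧ elem y L) e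
  ... | inj₁ e₁ with ∧-elim ⌊ w ≟ x ⌋ e₁
  ...   | w≡x , y∈L rewrite ≟-sound w≡x = elem-here x L , ∨-introʳ _ y∈L
  before⇒elem (w ∷ L) x y e | inj₂ e₂ =
    let x∈L , y∈L = before⇒elem L x y e₂ in ∨-introʳ _ x∈L , ∨-introʳ _ y∈L

  before⇒position< : ∀ L → Unique L → ∀ x y → before L x y ≡ true → position x L < position y L
  before⇒position< (w ∷ L) (w∉ ∷ uL) x y e with ∨-elim (⌊ w ≟ x ⌋ ∧ elem y L) e
  ... | inj₁ e₁ with ∧-elim ⌊ w ≟ x ⌋ e₁
  ...   | w≡x , y∈L rewrite ≟-sound w≡x | ≟-refl x
    | position-there L (λ y≡x → elem-distinct L (All≢⇒elem≡false x L w∉) y∈L (sym y≡x)) = s≤s z≤n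
  before⇒position< (w ∷ L) (w∉ ∷ uL) x y e | inj₂ e₂ with before⇒elem L x y e₂
  ... | x∈L , y∈L
    rewrite position-there L (λ x≡w → elem-distinct L (All≢⇒elem≡false w L w∉) x∈L (sym x≡w))
          | position-there L (λ y≡w → elem-distinct L (All≢⇒elem≡false w L w∉) y∈L (sym y≡w))
    = s≤s (before⇒position< L uL x y e₂)

  before-∉ʳ : ∀ L x y → elem y L ≡ false → before L x y ≡ false
  before-∉ʳ L x y y∉ with before L x y in eq
  ... | false = refl
  ... | true  = ⊥-elim (true≢false (trans (sym (proj₂ (before⇒elem L x y eq))) y∉))

  before-split : ∀ P v post → Unique (P ++ v ∷ post) → ∀ u → before (P ++ v ∷ post) u v ≡ elem u P
  before-split [] v post (v∉ ∷ _) u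
    rewrite before-∉ʳ post u v (All≢⇒elem≡false v post v∉) | All≢⇒elem≡false v post v∉ =
    trans (∨-identityʳ _) (∧-zeroʳ ⌊ v ≟ u ⌋)
  before-split (w ∷ P) v post (_ ∷ u') u
    rewrite before-split P v post u' u | ≟-sym w u | elem-++ʳ v P (v ∷ post) (elem-here v post)
          | ∧-identityʳ ⌊ u ≟ w ⌋ = refl

  before-++ˡ : ∀ A B u v → before A u v ≡ true → before (A ++ B) u v ≡ true
  before-++ˡ (a ∷ A) B u v e with ∨-elim (⌊ a ≟ u ⌋ ∧ elem v A) e
  ... | inj₁ e₁ with ∧-elim ⌊ a ≟ u ⌋ e₁
  ...   | a≡u , v∈A rewrite a≡u | elem-++ˡ v A B v∈A = refl
  before-++ˡ (a ∷ A) B u v e | inj₂ e₂ = ∨-introʳ _ (before-++ˡ A B u v e₂)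

  before-++ʳ : ∀ A B u v → before B u v ≡ true → before (A ++ B) u v ≡ true
  before-++ʳ []      B u v e = e
  before-++ʳ (a ∷ A) B u v e = ∨-introʳ _ (before-++ʳ A B u v e)

  before-++-across : ∀ A B u v → elem u A ≡ true → elem v B ≡ true → before (A ++ B) u v ≡ true
  before-++-across (a ∷ A) B u v u∈ v∈ with u ≟ a
  ... | yes refl rewrite ≟-refl u | elem-++ʳ v A B v∈ = refl
  ... | no _     = ∨-introʳ _ (before-++-across A B u v u∈ v∈)

-- Mechanics of chip-firing

module Firing {n : ℕ} (G : Digraph n) (s : Fin n) where
  open ChipFiring G s
  open Membership G s

  arcℕ : Fin n → Fin n → ℕ
  arcℕ u v = b2n (arc G u v)

  ≈-refl : ∀ {a} → a ≈ a
  ≈-refl _ _ = refl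

  ≈-sym : ∀ {a b} → a ≈ b → b ≈ a
  ≈-sym a≈b t t≢s = sym (a≈b t t≢s)

  ≈-trans : ∀ {a b c} → a ≈ b → b ≈ c → a ≈ c
  ≈-trans a≈b b≈c t t≢s = trans (a≈b t t≢s) (b≈c t t≢s)

  fireSeq-++ : ∀ a A B → fireSeq a (A ++ B) ≡ fireSeq (fireSeq a A) B
  fireSeq-++ a []      B = refl
  fireSeq-++ a (v ∷ A) B = fireSeq-++ (fire a v) A B

  Legal-++⁻ : ∀ a A B → Legal a (A ++ B) → Legal a A × Legal (fireSeq a A) B
  Legal-++⁻ a []      B l         = _ , l
  Legal-++⁻ a (v ∷ A) B (act , l) = let lA , lB = Legal-++⁻ (fire a v) A B l in (act , lA) , lB

  Legal-++⁺ : ∀ a A B → Legal a A → Legal (fireSeq a A) B → Legal a (A ++ B)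
  Legal-++⁺ a []      B _          lB = lB
  Legal-++⁺ a (v ∷ A) B (act , lA) lB = act , Legal-++⁺ (fire a v) A B lA lB

  fire-cong : ∀ {a b} v → a ≈ b → fire a v ≈ fire b v
  fire-cong v a≈b t t≢s rewrite a≈b t t≢s = refl

  Active-cong : ∀ {a b} v → a ≈ b → Active a v → Active b v
  Active-cong v a≈b (v≢s , pos , enough) = v≢s , pos , subst (outdeg G v ≤_) (a≈b v v≢s) enough

  Legal-cong : ∀ {a b} L → a ≈ b → Legal a L → Legal b L
  Legal-cong []      a≈b _         = _
  Legal-cong (v ∷ L) a≈b (act , l) = Active-cong v a≈b act , Legal-cong L (fire-cong v a≈b) l

  fireSeq-cong : ∀ {a b} L → a ≈ b → fireSeq a L ≈ fireSeq b L
  fireSeq-cong []      a≈b = a≈b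
  fireSeq-cong (v ∷ L) a≈b = fireSeq-cong L (fire-cong v a≈b)

  fire-⊕ : ∀ a f v → outdeg G v ≤ a v → ∀ t → fire (a ⊕ f) v t ≡ (fire a v ⊕ f) t
  fire-⊕ a f v enough t with ⌊ t ≟ v ⌋ in t≟v
  ... | true rewrite ≟-sound t≟v =
    trans (cong (_+ arcℕ v v) (+-∸-comm (f v) enough)) (xy∙z≈xz∙y (a v ∸ outdeg G v) (f v) (arcℕ v v))
  ... | false = xy∙z≈xz∙y (a t) (f t) (arcℕ v t)

  Legal-⊕ : ∀ a f L → Legal a L → Legal (a ⊕ f) L × fireSeq (a ⊕ f) L ≈ (fireSeq a L ⊕ f)
  Legal-⊕ a f []      _ = _ , ≈-refl
  Legal-⊕ a f (v ∷ L) ((v≢s , pos , enough) , l) =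
    let l′ , final = Legal-⊕ (fire a v) f L l
        fired≈ : (fire a v ⊕ f) ≈ fire (a ⊕ f) v
        fired≈ t _ = sym (fire-⊕ a f v enough t)
    in  ((v≢s , pos , ≤-trans enough (m≤m+n (a v) (f v))) , Legal-cong L fired≈ l′)
      , ≈-trans (fireSeq-cong L (≈-sym fired≈)) final

  ⟶*-⊕ : ∀ {a b} f → a ⟶* b → (a ⊕ f) ⟶* (b ⊕ f)
  ⟶*-⊕ {a} f (L , l , a→b) =
    let l′ , final = Legal-⊕ a f L l in L , l′ , ≈-trans final (λ t t≢s → cong (_+ f t) (a→b t t≢s))

  ≈⇒⟶* : ∀ {a b} → a ≈ b → a ⟶* b
  ≈⇒⟶* a≈b = [] , _ , a≈b

  ⟶*-respˡ : ∀ {a a′ b} → a ≈ a′ → a ⟶* b → a′ ⟶* b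
  ⟶*-respˡ a≈a′ (L , l , final) = L , Legal-cong L a≈a′ l , ≈-trans (fireSeq-cong L (≈-sym a≈a′)) final

  ⟶*-trans : ∀ {a b c} → a ⟶* b → b ⟶* c → a ⟶* c
  ⟶*-trans {a} {b} (A , lA , a→b) (B , lB , b→c) =
      A ++ B
    , Legal-++⁺ a A B lA (Legal-cong B (≈-sym a→b) lB)
    , λ t t≢s → trans (cong (λ g → g t) (fireSeq-++ a A B))
                      (trans (fireSeq-cong B a→b t t≢s) (b→c t t≢s))

  sent : Fin n → List (Fin n) → ℕ
  sent t L = sum (map (λ u → if ⌊ t ≟ u ⌋ then outdeg G t else 0) L)

  received : Fin n → List (Fin n) → ℕ
  received t L = sum (map (λ u → arcℕ u t) L)

  fire-balance : ∀ a v → outdeg G v ≤ a v → ∀ t →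
    fire a v t + (if ⌊ t ≟ v ⌋ then outdeg G t else 0) ≡ a t + arcℕ v t
  fire-balance a v enough t with ⌊ t ≟ v ⌋ in t≟v
  ... | true rewrite ≟-sound t≟v =
    trans (xy∙z≈xz∙y (a v ∸ outdeg G v) (arcℕ v v) (outdeg G v))
          (cong (_+ arcℕ v v) (m∸n+n≡m enough))
  ... | false = +-identityʳ _

  chip-conservation : ∀ a L → Legal a L → ∀ t → fireSeq a L t + sent t L ≡ a t + received t L
  chip-conservation a []      _ t = refl
  chip-conservation a (v ∷ L) ((_ , _ , enough) , l) t = begin
    fireSeq (fire a v) L t + (δ + sent t L)        ≡⟨ x∙yz≈xz∙y _ δ (sent t L) ⟩
    fireSeq (fire a v) L t + sent t L + δ          ≡⟨ cong (_+ δ) (chip-conservation (fire a v) L l t) ⟩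
    fire a v t + received t L + δ                  ≡⟨ xy∙z≈xz∙y (fire a v t) (received t L) δ ⟩
    fire a v t + δ + received t L                  ≡⟨ cong (_+ received t L) (fire-balance a v enough t) ⟩
    a t + arcℕ v t + received t L                  ≡⟨ +-assoc (a t) _ _ ⟩
    a t + (arcℕ v t + received t L)                ∎
    where
    open ≡-Reasoning
    δ : ℕ
    δ = if ⌊ t ≟ v ⌋ then outdeg G t else 0

  sent-∉ : ∀ t L → elem t L ≡ false → sent t L ≡ 0
  sent-∉ t []      _ = refl
  sent-∉ t (u ∷ L) e with t ≟ u
  ... | no _ = sent-∉ t L e

  sent-∈ : ∀ t L → elem t L ≡ true → outdeg G t ≤ sent t L
  sent-∈ t (u ∷ L) e with t ≟ u
  ... | yes _ = m≤m+n _ _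
  ... | no _  = sent-∈ t L e

  sent-unique : ∀ t L → Unique L → elem t L ≡ true → sent t L ≡ outdeg G t
  sent-unique t L uL t∈L = begin
    sent t L                                                 ≡⟨ ∑-elem δ L uL ⟨
    ∑ (λ u → if elem u L then δ u else 0)                    ≡⟨ ∑-pointed _ t off-t ⟩
    (if elem t L then δ t else 0)                            ≡⟨ cong₂ (λ b c → if b then (if c then outdeg G t else 0) else 0) t∈L (≟-refl t) ⟩
    outdeg G t                                               ∎
    where
    open ≡-Reasoning
    δ : Fin n → ℕ
    δ u = if ⌊ t ≟ u ⌋ then outdeg G t else 0
    off-t : ∀ u → u ≢ t → (if elem u L then δ u else 0) ≡ 0
    off-t u u≢t rewrite ≟-≢ (u≢t ∘ sym) with elem u L
    ... | true  = refl
    ... | false = refl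

  Legal⇒sink∉ : ∀ a L → Legal a L → elem s L ≡ false
  Legal⇒sink∉ a []      _                  = refl
  Legal⇒sink∉ a (v ∷ L) ((v≢s , _) , l) rewrite ≟-≢ (v≢s ∘ sym) = Legal⇒sink∉ (fire a v) L l

-- The burning criterion for recurrence

module Burning {n : ℕ} (G : Digraph n) (s : Fin n) where
  open ChipFiring G s
  open Membership G s
  open Firing G s

  fromEarlier : List (Fin n) → Fin n → ℕ
  fromEarlier L v = ∑ λ u → if before L u v then arcℕ u v else 0

  record EnumeratesNonSinks (L : List (Fin n)) : Set where
    field
      unique : Unique L
      sink∉  : elem s L ≡ false
      covers : ∀ v → v ≢ s → elem v L ≡ true

  Burnable : Config n → List (Fin n) → Set
  Burnable r L = ∀ v → elem v L ≡ true → outdeg G v ≤ r v + β v + fromEarlier L v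

  chips-at-turn : ∀ r {L} P v post → P ++ v ∷ post ≡ L → Unique L → Legal (r ⊕ β) P →
    fireSeq (r ⊕ β) P v ≡ r v + β v + fromEarlier L v
  chips-at-turn r P v post refl u lP = begin
    fireSeq (r ⊕ β) P v                                       ≡⟨ +-identityʳ _ ⟨
    fireSeq (r ⊕ β) P v + 0                                   ≡⟨ cong (fireSeq (r ⊕ β) P v +_) (sent-∉ v P (Unique⇒∉prefix P v post u)) ⟨
    fireSeq (r ⊕ β) P v + sent v P                            ≡⟨ chip-conservation (r ⊕ β) P lP v ⟩
    r v + β v + received v P                                  ≡⟨ cong (r v + β v +_) (∑-elem (λ u → arcℕ u v) P (Unique-++⁻ˡ P _ u)) ⟨
    r v + β v + ∑ (λ u → if elem u P then arcℕ u v else 0)   ≡⟨ cong (r v + β v +_) (sum-cong-≗ earlier) ⟩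
    r v + β v + fromEarlier (P ++ v ∷ post) v                 ∎
    where
    open ≡-Reasoning
    earlier : ∀ w → (if elem w P then arcℕ w v else 0) ≡ (if before (P ++ v ∷ post) w v then arcℕ w v else 0)
    earlier w = cong (λ b → if b then arcℕ w v else 0) (sym (before-split P v post u w))

  indeg-except : ∀ v → indeg G v ≡ β v + ∑ (except s (λ u → arcℕ u v))
  indeg-except v = trans (sumV≡∑ (λ u → arcℕ u v)) (∑-except (λ u → arcℕ u v) s)

  β+received≤indeg : ∀ v P → Unique P → elem s P ≡ false → β v + received v P ≤ indeg G v
  β+received≤indeg v P uP s∉P = begin
    β v + received v P                                        ≡⟨ cong (β v +_) (∑-elem (λ u → arcℕ u v) P uP) ⟨
    β v + ∑ (λ u → if elem u P then arcℕ u v else 0)         ≤⟨ +-monoʳ-≤ (β v) (∑-mono-≤ off-s) ⟩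
    β v + ∑ (except s (λ u → arcℕ u v))                       ≡⟨ indeg-except v ⟨
    indeg G v                                                 ∎
    where
    open ≤-Reasoning
    off-s : ∀ u → (if elem u P then arcℕ u v else 0) ≤ except s (λ u → arcℕ u v) u
    off-s u with elem u P in u∈P
    ... | false = z≤n
    ... | true rewrite ≟-≢ (elem-distinct P s∉P u∈P ∘ sym) = ≤-refl

  β+received≡indeg : ∀ v P → EnumeratesNonSinks P → β v + received v P ≡ indeg G v
  β+received≡indeg v P enum = begin
    β v + received v P                                        ≡⟨ cong (β v +_) (∑-elem (λ u → arcℕ u v) P unique) ⟨
    β v + ∑ (λ u → if elem u P then arcℕ u v else 0)         ≡⟨ cong (β v +_) (sum-cong-≗ on-P) ⟩
    β v + ∑ (except s (λ u → arcℕ u v))                       ≡⟨ indeg-except v ⟨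
    indeg G v                                                 ∎
    where
    open ≡-Reasoning
    open EnumeratesNonSinks enum
    on-P : ∀ u → (if elem u P then arcℕ u v else 0) ≡ except s (λ u → arcℕ u v) u
    on-P u with u ≟ s
    ... | yes refl rewrite sink∉ = refl
    ... | no u≢s   rewrite covers u u≢s = refl

  module _ (eulerian : Eulerian G) (out-pos : ∀ v → v ≢ s → 1 ≤ outdeg G v)
           {r : Config n} {L : List (Fin n)} (enum : EnumeratesNonSinks L) (burnable : Burnable r L) where
    open EnumeratesNonSinks enum

    burning-legal : Legal (r ⊕ β) L
    burning-legal = prefix-induction L (Legal (r ⊕ β)) _ step
      where
      step : ∀ P v post → P ++ v ∷ post ≡ L → Legal (r ⊕ β) P → Legal (r ⊕ β) (P ++ v ∷ [])
      step P v post eq lP = Legal-++⁺ (r ⊕ β) P (v ∷ []) lP ((v≢s , out-pos v v≢s , enough) , _)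
        where
        v∈L : elem v L ≡ true
        v∈L = subst (λ L → elem v L ≡ true) eq (elem-++ʳ v P (v ∷ post) (elem-here v post))
        v≢s : v ≢ s
        v≢s v≡s = elem-distinct L sink∉ v∈L (sym v≡s)
        enough : outdeg G v ≤ fireSeq (r ⊕ β) P v
        enough = subst (outdeg G v ≤_)
          (sym (chips-at-turn r P v post eq unique lP))
          (burnable v v∈L)

    burning-returns : fireSeq (r ⊕ β) L ≈ r
    burning-returns v v≢s = +-cancelʳ-≡ (outdeg G v) _ (r v) (begin
      fireSeq (r ⊕ β) L v + outdeg G v              ≡⟨ cong (fireSeq (r ⊕ β) L v +_) (sent-unique v L unique (covers v v≢s)) ⟨
      fireSeq (r ⊕ β) L v + sent v L                ≡⟨ chip-conservation (r ⊕ β) L burning-legal v ⟩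
      r v + β v + received v L                      ≡⟨ +-assoc (r v) (β v) _ ⟩
      r v + (β v + received v L)                    ≡⟨ cong (r v +_) (trans (β+received≡indeg v L enum) (eulerian v)) ⟩
      r v + outdeg G v                              ∎)
      where open ≡-Reasoning

  -- If firing every non-sink vertex once from r + β returns to r, every configuration can be
  -- topped up to one that relaxes to r: chips are added one vertex at a time, in firing order.
  module _ {r : Config n} (stable : Stable r) {L : List (Fin n)}
           (legal : Legal (r ⊕ β) L) (returns : fireSeq (r ⊕ β) L ≈ r) where

    Restorable : Config n → Set
    Restorable z = ∃ λ e → ((r ⊕ z) ⊕ e) ⟶* r

    SupportedOn : List (Fin n) → Config n → Set
    SupportedOn P z = ∀ v → v ≢ s → elem v P ≡ false → z v ≡ 0

    AllRestorable : List (Fin n) → Set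
    AllRestorable P = ∀ z → SupportedOn P z → Restorable z

    restorable-[] : AllRestorable []
    restorable-[] z supp = (λ _ → 0) , ≈⇒⟶* no-chips
      where
      no-chips : ((r ⊕ z) ⊕ (λ _ → 0)) ≈ r
      no-chips t t≢s rewrite supp t t≢s refl = trans (+-identityʳ _) (+-identityʳ _)

    supported-snoc⁻ : ∀ P y z → SupportedOn (P ++ y ∷ []) z → (elem y P ≡ true ⊎ z y ≡ 0) → SupportedOn P z
    supported-snoc⁻ P y z supp y-ok v v≢s v∉P with v ≟ y | y-ok
    ... | yes refl | inj₁ y∈P = ⊥-elim (true≢false (trans (sym y∈P) v∉P))
    ... | yes refl | inj₂ zy  = zy
    ... | no v≢y   | _        = supp v v≢s (trans (elem-++ v P (y ∷ [])) (cong₂ _∨_ v∉P (cong (_∨ false) (≟-≢ v≢y))))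

    module Turn (P : List (Fin n)) (y : Fin n) (post : List (Fin n)) (eq : P ++ y ∷ post ≡ L)
                (y∉P : elem y P ≡ false) (restorable-P : AllRestorable P) where

      X : Config n
      X = fireSeq (r ⊕ β) P

      legal-split : Legal (r ⊕ β) P × Legal X (y ∷ post)
      legal-split = Legal-++⁻ (r ⊕ β) P (y ∷ post) (subst (Legal (r ⊕ β)) (sym eq) legal)

      X⟶*r : X ⟶* r
      X⟶*r = y ∷ post , proj₂ legal-split , λ t t≢s →
        trans (cong (λ g → g t) (sym (fireSeq-++ (r ⊕ β) P (y ∷ post))))
              (trans (cong (λ L → fireSeq (r ⊕ β) L t) eq) (returns t t≢s))

      r<X-at-y : r y < X y
      r<X-at-y with proj₁ (proj₂ legal-split)
      ... | y≢s , pos , enough with outdeg G y ≤? r y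
      ...   | yes r-enough = ⊥-elim (stable y (y≢s , pos , r-enough))
      ...   | no  r-short  = <-≤-trans (≰⇒> r-short) enough

      r≤X-off-P : ∀ t → elem t P ≡ false → r t ≤ X t
      r≤X-off-P t t∉P = begin
        r t                                      ≤⟨ m≤m+n (r t) (β t + received t P) ⟩
        r t + (β t + received t P)               ≡⟨ +-assoc (r t) (β t) _ ⟨
        r t + β t + received t P                 ≡⟨ chip-conservation (r ⊕ β) P (proj₁ legal-split) t ⟨
        X t + sent t P                           ≡⟨ cong (X t +_) (sent-∉ t P t∉P) ⟩
        X t + 0                                  ≡⟨ +-identityʳ (X t) ⟩
        X t                                      ∎
        where open ≤-Reasoning

      -- f keeps k chips at y; the rest of z on P is moved into f, and e supplies what X needs
      module Shift (k : ℕ) (z : Config n) (zy : z y ≡ suc k) (supp : SupportedOn (P ++ y ∷ []) z) where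

        f e : Config n
        f t = if elem t P then r t + z t else (if ⌊ t ≟ y ⌋ then k else 0)
        e t = if elem t P then X t else (if ⌊ t ≟ y ⌋ then X t ∸ suc (r t) else X t ∸ r t)

        f-supp : SupportedOn (P ++ y ∷ []) f
        f-supp v v≢s v∉ with elem v P in v∈P | v ≟ y
        ... | true  | _        = ⊥-elim (true≢false (trans (sym (elem-++ˡ v P (y ∷ []) v∈P)) v∉))
        ... | false | yes refl = ⊥-elim (true≢false (trans (sym (elem-++ʳ v P (y ∷ []) (elem-here v []))) v∉))
        ... | false | no _     = refl

        f-at-y : f y ≡ k
        f-at-y rewrite y∉P | ≟-refl y = refl

        top-up : ∀ r k X → r < X → r + suc k + (X ∸ suc r) ≡ X + k
        top-up r k X r<X = trans (rearrange r k (X ∸ suc r)) (cong (_+ k) (m+[n∸m]≡n r<X))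
          where
          rearrange : ∀ r k m → r + suc k + m ≡ suc r + m + k
          rearrange = solve-∀

        balance : ∀ t → t ≢ s → (r ⊕ z) t + e t ≡ X t + f t
        balance t t≢s with elem t P in t∈P | t ≟ y
        ... | true  | _        = +-comm (r t + z t) (X t)
        ... | false | yes refl rewrite zy = top-up (r y) k (X y) r<X-at-y
        ... | false | no t≢y
          rewrite supp t t≢s (trans (elem-++ t P (y ∷ [])) (cong₂ _∨_ t∈P (cong (_∨ false) (≟-≢ t≢y))))
          = trans (cong (_+ (X t ∸ r t)) (+-identityʳ (r t)))
                  (trans (m+[n∸m]≡n (r≤X-off-P t t∈P)) (sym (+-identityʳ (X t))))

        start : ∀ e′ → (X ⊕ (f ⊕ e′)) ≈ ((r ⊕ z) ⊕ (e ⊕ e′))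
        start e′ t t≢s = begin
          X t + (f t + e′ t)            ≡⟨ +-assoc (X t) (f t) (e′ t) ⟨
          X t + f t + e′ t              ≡⟨ cong (_+ e′ t) (balance t t≢s) ⟨
          (r ⊕ z) t + e t + e′ t        ≡⟨ +-assoc ((r ⊕ z) t) (e t) (e′ t) ⟩
          (r ⊕ z) t + (e t + e′ t)      ∎
          where open ≡-Reasoning

      restorable-at : ∀ k z → z y ≡ k → SupportedOn (P ++ y ∷ []) z → Restorable z
      restorable-at zero    z zy supp = restorable-P z (supported-snoc⁻ P y z supp (inj₂ zy))
      restorable-at (suc k) z zy supp =
        let open Shift k z zy supp
            e′ , f⟶*r = restorable-at k f f-at-y f-supp
            regroup : ((r ⊕ f) ⊕ e′) ≈ (r ⊕ (f ⊕ e′))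
            regroup t _ = +-assoc (r t) (f t) (e′ t)
        in  e ⊕ e′ , ⟶*-respˡ (start e′) (⟶*-trans (⟶*-⊕ (f ⊕ e′) X⟶*r) (⟶*-respˡ regroup f⟶*r))

    restorable : AllRestorable L
    restorable = prefix-induction L AllRestorable restorable-[] step
      where
      step : ∀ P y post → P ++ y ∷ post ≡ L → AllRestorable P → AllRestorable (P ++ y ∷ [])
      step P y post eq restorable-P z supp with elem y P in y∈P
      ... | true  = restorable-P z (supported-snoc⁻ P y z supp (inj₁ y∈P))
      ... | false = Turn.restorable-at P y post eq y∈P restorable-P (z y) z refl supp

    burning⇒accessible : (∀ v → v ≢ s → elem v L ≡ true) → Accessible r
    burning⇒accessible covers d =
      let e , reach = restorable d (λ v v≢s v∉L → ⊥-elim (true≢false (trans (sym (covers v v≢s)) v∉L)))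
      in  r ⊕ e , ⟶*-respˡ (λ t _ → reorder (r t) (d t) (e t)) reach
      where
      reorder : ∀ a b c → a + b + c ≡ b + (a + c)
      reorder = solve-∀

  burning⇒recurrent : Eulerian G → (∀ v → v ≢ s → 1 ≤ outdeg G v) →
    ∀ {r L} → EnumeratesNonSinks L → Stable r → Burnable r L → Recurrent r
  burning⇒recurrent eulerian out-pos enum stable burnable =
    stable , burning⇒accessible stable (burning-legal eulerian out-pos enum burnable)
                                (burning-returns eulerian out-pos enum burnable)
                                (EnumeratesNonSinks.covers enum)

-- Connected Eulerian digraphs

sizeA≡∑indegA : ∀ {n} (A : ArcSet n) → sizeA A ≡ ∑ (indegA A)
sizeA≡∑indegA A = begin
  sizeA A                                   ≡⟨ sumV≡∑ (outdegA A) ⟩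
  ∑ (outdegA A)                             ≡⟨ sum-cong-≗ (λ u → sumV≡∑ (λ v → b2n (A u v))) ⟩
  ∑ (λ u → ∑ (λ v → b2n (A u v)))           ≡⟨ ∑-comm (λ u v → b2n (A u v)) ⟩
  ∑ (λ v → ∑ (λ u → b2n (A u v)))           ≡⟨ sum-cong-≗ (λ v → sumV≡∑ (λ u → b2n (A u v))) ⟨
  ∑ (indegA A)                              ∎
  where open ≡-Reasoning

module _ {n : ℕ} (G : Digraph n) where

  arc⇒1≤outdeg : ∀ {v w} → arc G v w ≡ true → 1 ≤ outdeg G v
  arc⇒1≤outdeg {v} {w} v→w = subst (1 ≤_) (sym (sumV≡∑ (λ x → b2n (arc G v x))))
    (≤-trans (subst (λ b → 1 ≤ b2n b) (sym v→w) ≤-refl) (≤∑ (λ x → b2n (arc G v x)) w))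

  arc⇒1≤indeg : ∀ {u v} → arc G u v ≡ true → 1 ≤ indeg G v
  arc⇒1≤indeg {u} {v} u→v = subst (1 ≤_) (sym (sumV≡∑ (λ x → b2n (arc G x v))))
    (≤-trans (subst (λ b → 1 ≤ b2n b) (sym u→v) ≤-refl) (≤∑ (λ x → b2n (arc G x v)) u))

  outdeg-pos : Connected G → Eulerian G → ∀ {v w} → v ≢ w → 1 ≤ outdeg G v
  outdeg-pos connected eulerian {v} {w} v≢w with connected v w
  ... | ε            = ⊥-elim (v≢w refl)
  ... | inj₁ v→x ◅ _ = arc⇒1≤outdeg v→x
  ... | inj₂ x→v ◅ _ = subst (1 ≤_) (eulerian v) (arc⇒1≤indeg x→v)

  InClosed OutClosed : (Fin n → Bool) → Set
  InClosed  U = ∀ t u → U t ≡ true → arc G u t ≡ true → U u ≡ true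
  OutClosed U = ∀ t w → U t ≡ true → arc G t w ≡ true → U w ≡ true

  module _ (U : Fin n → Bool) where

    within leaving : Fin n → Fin n → ℕ
    within  t w = b2n (U t ∧ U w ∧ arc G t w)
    leaving t w = b2n (U t ∧ not (U w) ∧ arc G t w)

    in-within : InClosed U → ∀ t x → (if U t then b2n (arc G x t) else 0) ≡ within x t
    in-within in-closed t x with U t in Ut | arc G x t in x→t
    ... | true  | true  rewrite in-closed t x Ut x→t = refl
    ... | true  | false = cong b2n (sym (∧-zeroʳ (U x)))
    ... | false | _     = cong b2n (sym (∧-zeroʳ (U x)))

    out-split : ∀ t w → (if U t then b2n (arc G t w) else 0) ≡ within t w + leaving t w
    out-split t w with U t | U w
    ... | true  | true  = sym (+-identityʳ _)
    ... | true  | false = refl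
    ... | false | _     = refl

    -- Counting arcs inside U: in-closure makes the in-degree sum over U count only arcs within U,
    -- and since it equals the out-degree sum no arc can leave U.
    no-leaving : Eulerian G → InClosed U → ∑ (λ t → ∑ (leaving t)) ≡ 0
    no-leaving eulerian in-closed = +-cancelˡ-≡ W _ 0 (begin
      W + ∑ (λ t → ∑ (leaving t))                                 ≡⟨ ∑-distrib-+ (λ t → ∑ (within t)) (λ t → ∑ (leaving t)) ⟨
      ∑ (λ t → ∑ (within t) + ∑ (leaving t))                      ≡⟨ sum-cong-≗ (λ t → ∑-distrib-+ (within t) (leaving t)) ⟨
      ∑ (λ t → ∑ (λ w → within t w + leaving t w))                ≡⟨ sum-cong-≗ (λ t → sum-cong-≗ (out-split t)) ⟨
      ∑ (λ t → ∑ (λ w → if U t then b2n (arc G t w) else 0))      ≡⟨ sum-cong-≗ out-as-∑ ⟨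
      ∑ (λ t → if U t then outdeg G t else 0)                     ≡⟨ sum-cong-≗ (λ t → cong (λ d → if U t then d else 0) (eulerian t)) ⟨
      ∑ (λ t → if U t then indeg G t else 0)                      ≡⟨ sum-cong-≗ in-as-∑ ⟩
      ∑ (λ t → ∑ (λ x → if U t then b2n (arc G x t) else 0))      ≡⟨ sum-cong-≗ (λ t → sum-cong-≗ (in-within in-closed t)) ⟩
      ∑ (λ t → ∑ (λ x → within x t))                              ≡⟨ ∑-comm within ⟨
      W                                                           ≡⟨ +-identityʳ W ⟨
      W + 0                                                       ∎)
      where
      open ≡-Reasoning
      W : ℕ
      W = ∑ (λ t → ∑ (within t))
      out-as-∑ : ∀ t → (if U t then outdeg G t else 0) ≡ ∑ (λ w → if U t then b2n (arc G t w) else 0)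
      out-as-∑ t = trans (cong (λ d → if U t then d else 0) (sumV≡∑ (λ w → b2n (arc G t w)))) (∑-if (U t) (λ w → b2n (arc G t w)))
      in-as-∑ : ∀ t → (if U t then indeg G t else 0) ≡ ∑ (λ x → if U t then b2n (arc G x t) else 0)
      in-as-∑ t = trans (cong (λ d → if U t then d else 0) (sumV≡∑ (λ x → b2n (arc G x t)))) (∑-if (U t) (λ x → b2n (arc G x t)))

  in-closed⇒out-closed : Eulerian G → ∀ U → InClosed U → OutClosed U
  in-closed⇒out-closed eulerian U in-closed t w Ut t→w with U w in Uw
  ... | true  = refl
  ... | false = ⊥-elim (1+n≢0 (trans leaves (∑≡0⇒≡0 (leaving U t) (∑≡0⇒≡0 _ (no-leaving U eulerian in-closed) t) w)))
    where
    leaves : 1 ≡ leaving U t w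
    leaves rewrite Ut | Uw | t→w = refl

  subset⇒b2n≤ : ∀ {A} → SubsetOf A G → ∀ u v → b2n (A u v) ≤ b2n (arc G u v)
  subset⇒b2n≤ {A} A⊆G u v with A u v in u→v
  ... | true  rewrite A⊆G u v u→v = ≤-refl
  ... | false = z≤n

  subset⇒indeg≤ : ∀ {A} → SubsetOf A G → ∀ v → indegA A v ≤ indeg G v
  subset⇒indeg≤ {A} A⊆G v = subst₂ _≤_ (sym (sumV≡∑ (λ u → b2n (A u v)))) (sym (sumV≡∑ (λ u → b2n (arc G u v))))
    (∑-mono-≤ λ u → subset⇒b2n≤ A⊆G u v)

  subset⇒indeg< : ∀ {A} → SubsetOf A G → ∀ {u v} → arc G u v ≡ true → A u v ≡ false → indegA A v < indeg G v
  subset⇒indeg< {A} A⊆G {u} {v} u→v u↛v = subst₂ _<_ (sym (sumV≡∑ (λ u → b2n (A u v)))) (sym (sumV≡∑ (λ u → b2n (arc G u v))))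
    (∑-mono-< u (λ u → subset⇒b2n≤ A⊆G u v) (subst₂ (λ a b → b2n a < b2n b) (sym u↛v) (sym u→v) ≤-refl))

  closed-connected : Connected G → ∀ U → InClosed U → OutClosed U → ∀ x y → U x ≡ true → U y ≡ true
  closed-connected connected U in-closed out-closed x y = go (connected x y)
    where
    go : ∀ {a b} → Star (UAdj G) a b → U a ≡ true → U b ≡ true
    go ε                Ua = Ua
    go (inj₁ a→b ◅ path) Ua = go path (out-closed _ _ Ua a→b)
    go (inj₂ b→a ◅ path) Ua = go path (in-closed _ _ Ua b→a)

-- Arc sets ranked by a strictly increasing function

anyFin : ∀ {n} → (Fin n → Bool) → Bool
anyFin {zero}  p = false
anyFin {suc n} p = p zero ∨ anyFin (p ∘ suc)

anyFin-intro : ∀ {n} (p : Fin n → Bool) u → p u ≡ true → anyFin p ≡ true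
anyFin-intro p zero    e = ∨-introˡ e
anyFin-intro p (suc u) e = ∨-introʳ (p zero) (anyFin-intro (p ∘ suc) u e)

anyFin-elim : ∀ {n} (p : Fin n → Bool) → anyFin p ≡ true → ∃ λ u → p u ≡ true
anyFin-elim {suc n} p e with ∨-elim (p zero) e
... | inj₁ e₀ = zero , e₀
... | inj₂ e₁ = let u , pu = anyFin-elim (p ∘ suc) e₁ in suc u , pu

walk-snoc : ∀ {n} (A : ArcSet n) u ys t w → WalkFrom A u ys t → A t w ≡ true → WalkFrom A u (ys ++ t ∷ []) w
walk-snoc A u []       t w u→t t→w = u→t , t→w
walk-snoc A u (y ∷ ys) t w (u→y , walk) t→w = u→y , walk-snoc A y ys t w walk t→w

walk-mono : ∀ {n} {A B : ArcSet n} → (∀ a b → A a b ≡ true → B a b ≡ true) →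
  ∀ u ys t → WalkFrom A u ys t → WalkFrom B u ys t
walk-mono A⊆B u []       t u→t          = A⊆B u t u→t
walk-mono A⊆B u (y ∷ ys) t (u→y , walk) = A⊆B u y u→y , walk-mono A⊆B y ys t walk

module Ranked {n : ℕ} (A : ArcSet n) (rank : Fin n → ℕ) (ranked : ∀ u v → A u v ≡ true → rank u < rank v) where

  walk-rank : ∀ u ys t → WalkFrom A u ys t → rank u < rank t
  walk-rank u []       t u→t          = ranked u t u→t
  walk-rank u (y ∷ ys) t (u→y , walk) = <-trans (ranked u y u→y) (walk-rank y ys t walk)

  rank<⇒≢ : ∀ {u z} → rank u < rank z → u ≢ z
  rank<⇒≢ lt refl = <-irrefl refl lt

  walk-above : ∀ u ys t → WalkFrom A u ys t → All (λ z → rank u < rank z) (ys ++ t ∷ [])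
  walk-above u []       t u→t          = ranked u t u→t ∷ []
  walk-above u (y ∷ ys) t (u→y , walk) =
    ranked u y u→y ∷ All.map (<-trans (ranked u y u→y)) (walk-above y ys t walk)

  walk-unique : ∀ u ys t → WalkFrom A u ys t → Unique (u ∷ ys ++ t ∷ [])
  walk-unique u []       t walk = All.map rank<⇒≢ (walk-above u [] t walk) ∷ [] ∷ []
  walk-unique u (y ∷ ys) t walk = All.map rank<⇒≢ (walk-above u (y ∷ ys) t walk) ∷ walk-unique y ys t (proj₂ walk)

  ranked⇒acyclic : ¬ HasCycle A
  ranked⇒acyclic (x ∷ xs , _ , walk) = <-irrefl refl (walk-rank x xs x walk)

  walk⇒cycle-addArc : ∀ x y ys → WalkFrom A y ys x → HasCycle (addArc A x y)
  walk⇒cycle-addArc x y ys walk =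
      y ∷ ys ++ x ∷ []
    , walk-unique y ys x walk
    , walk-snoc (addArc A x y) y ys x y (walk-mono (λ _ _ → ∨-introˡ) y ys x walk) new-arc
    where
    new-arc : addArc A x y x y ≡ true
    new-arc rewrite ≟-refl x | ≟-refl y = ∨-introʳ (A x y) refl

  reachable-from-root : ∀ root → (∀ v → v ≢ root → ∃ λ u → A u v ≡ true) →
    ∀ v → v ≢ root → ∃ λ ys → WalkFrom A root ys v
  reachable-from-root root has-in-arc v v≢root = go (rank v) v v≢root ≤-refl
    where
    go : ∀ k v → v ≢ root → rank v ≤ k → ∃ λ ys → WalkFrom A root ys v
    go k v v≢root rank≤k with has-in-arc v v≢root
    ... | u , u→v with u ≟ root | k
    ...   | yes refl | _     = [] , u→v
    ...   | no _     | zero  = ⊥-elim (≤⇒≯ rank≤k (≤-trans (s≤s z≤n) (ranked u v u→v)))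
    ...   | no u≢root | suc k′ =
      let ys , walk = go k′ u u≢root (≤-pred (≤-trans (ranked u v u→v) rank≤k))
      in  ys ++ u ∷ [] , walk-snoc A root ys u v walk u→v

  -- ranks grow along arcs and are at most N, so walks of length at most N reach every descendant of y
  module Descendants (N : ℕ) (bounded : ∀ v → rank v ≤ N) (y : Fin n) where

    reachedIn : ℕ → Fin n → Bool
    reachedIn zero    v = ⌊ v ≟ y ⌋
    reachedIn (suc k) v = anyFin λ u → reachedIn k u ∧ A u v

    reachedWithin : ℕ → Fin n → Bool
    reachedWithin zero    v = reachedIn zero v
    reachedWithin (suc K) v = reachedWithin K v ∨ reachedIn (suc K) v

    descendant : Fin n → Bool
    descendant = reachedWithin N

    reachedIn-rank : ∀ k v → reachedIn k v ≡ true → k + rank y ≤ rank v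
    reachedIn-rank zero    v e = ≤-reflexive (cong rank (sym (≟-sound e)))
    reachedIn-rank (suc k) v e with anyFin-elim _ e
    ... | u , e′ with ∧-elim (reachedIn k u) e′
    ...   | reached , u→v = <-≤-trans (s≤s (reachedIn-rank k u reached)) (ranked u v u→v)

    reachedIn⇒walk : ∀ k v → reachedIn k v ≡ true → v ≡ y ⊎ ∃ λ ys → WalkFrom A y ys v
    reachedIn⇒walk zero    v e = inj₁ (≟-sound e)
    reachedIn⇒walk (suc k) v e with anyFin-elim _ e
    ... | u , e′ with ∧-elim (reachedIn k u) e′
    ...   | reached , u→v with reachedIn⇒walk k u reached
    ...     | inj₁ refl         = inj₂ ([] , u→v)
    ...     | inj₂ (ys , walk)  = inj₂ (ys ++ u ∷ [] , walk-snoc A y ys u v walk u→v)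

    reachedWithin⁻ : ∀ K v → reachedWithin K v ≡ true → ∃ λ k → k ≤ K × reachedIn k v ≡ true
    reachedWithin⁻ zero    v e = zero , z≤n , e
    reachedWithin⁻ (suc K) v e with ∨-elim (reachedWithin K v) e
    ... | inj₁ e₁ = let k , k≤K , r = reachedWithin⁻ K v e₁ in k , m≤n⇒m≤1+n k≤K , r
    ... | inj₂ e₂ = suc K , ≤-refl , e₂

    reachedWithin⁺ : ∀ K k v → k ≤ K → reachedIn k v ≡ true → reachedWithin K v ≡ true
    reachedWithin⁺ zero    zero v z≤n e = e
    reachedWithin⁺ (suc K) k    v k≤K e with k ≤? K
    ... | yes k≤K′ = ∨-introˡ (reachedWithin⁺ K k v k≤K′ e)
    ... | no  k≰K′ = ∨-introʳ (reachedWithin K v) (subst (λ j → reachedIn j v ≡ true) (≤-antisym k≤K (≰⇒> k≰K′)) e)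

    descendant-root : descendant y ≡ true
    descendant-root = reachedWithin⁺ N zero y z≤n (≟-refl y)

    descendant-closed : ∀ u t → descendant u ≡ true → A u t ≡ true → descendant t ≡ true
    descendant-closed u t du u→t with reachedWithin⁻ N u du
    ... | k , _ , reached =
      reachedWithin⁺ N (suc k) t k<N (anyFin-intro (λ w → reachedIn k w ∧ A w t) u (∧-intro reached u→t))
      where
      k<N : suc k ≤ N
      k<N = ≤-trans (m≤m+n (suc k) (rank y))
              (≤-trans (<-≤-trans (s≤s (reachedIn-rank k u reached)) (ranked u t u→t)) (bounded t))

    descendant⇒walk : ∀ v → descendant v ≡ true → v ≡ y ⊎ ∃ λ ys → WalkFrom A y ys v
    descendant⇒walk v dv = let k , _ , reached = reachedWithin⁻ N v dv in reachedIn⇒walk k v reached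

-- Moving a set of vertices to the end of a firing order

module Partition {n : ℕ} (G : Digraph n) (s : Fin n) where
  open ChipFiring G s
  open Membership G s
  open Burning G s

  elem-bfilter⁻ : ∀ (p : Fin n → Bool) v L → elem v (bfilter p L) ≡ true → p v ≡ true × elem v L ≡ true
  elem-bfilter⁻ p v (w ∷ L) e with p w in pw
  ... | false = let pv , v∈L = elem-bfilter⁻ p v L e in pv , ∨-introʳ _ v∈L
  ... | true with v ≟ w
  ...   | yes refl = pw , refl
  ...   | no _     = elem-bfilter⁻ p v L e

  elem-bfilter⁺ : ∀ (p : Fin n → Bool) v L → p v ≡ true → elem v L ≡ true → elem v (bfilter p L) ≡ true
  elem-bfilter⁺ p v (w ∷ L) pv e with v ≟ w
  ... | yes refl rewrite pv = elem-here v (bfilter p L)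
  ... | no _ with p w
  ...   | true  = ∨-introʳ _ (elem-bfilter⁺ p v L pv e)
  ...   | false = elem-bfilter⁺ p v L pv e

  before-bfilter : ∀ (p : Fin n → Bool) u v L → p u ≡ true → p v ≡ true →
    before L u v ≡ true → before (bfilter p L) u v ≡ true
  before-bfilter p u v (w ∷ L) pu pv e with ∨-elim (⌊ w ≟ u ⌋ ∧ elem v L) e
  ... | inj₁ e₁ with ∧-elim ⌊ w ≟ u ⌋ e₁
  ...   | w≡u , v∈L rewrite ≟-sound w≡u | pu | ≟-refl u = ∨-introˡ (elem-bfilter⁺ p v L pv v∈L)
  before-bfilter p u v (w ∷ L) pu pv e | inj₂ e₂ with p w
  ... | true  = ∨-introʳ _ (before-bfilter p u v L pu pv e₂)
  ... | false = before-bfilter p u v L pu pv e₂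

  module _ (D : Fin n → Bool) (L : List (Fin n)) where

    kept moved partitioned : List (Fin n)
    kept        = bfilter (not ∘ D) L
    moved       = bfilter D L
    partitioned = kept ++ moved

    elem-partitioned : ∀ v → elem v partitioned ≡ elem v L
    elem-partitioned v with elem v L in v∈L | D v in Dv
    ... | true  | true  = elem-++ʳ v kept moved (elem-bfilter⁺ D v L Dv v∈L)
    ... | true  | false = elem-++ˡ v kept moved (elem-bfilter⁺ (not ∘ D) v L (cong not Dv) v∈L)
    ... | false | _ with elem v partitioned in v∈P
    ...   | false = refl
    ...   | true with ∨-elim (elem v kept) (trans (sym (elem-++ v kept moved)) v∈P)
    ...     | inj₁ e = ⊥-elim (true≢false (trans (sym (proj₂ (elem-bfilter⁻ _ v L e))) v∈L))
    ...     | inj₂ e = ⊥-elim (true≢false (trans (sym (proj₂ (elem-bfilter⁻ _ v L e))) v∈L))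

    partitioned-enumerates : EnumeratesNonSinks L → EnumeratesNonSinks partitioned
    partitioned-enumerates enum = record
      { unique = Unique-++ kept moved (Unique-bfilter (not ∘ D) L unique) (Unique-bfilter D L unique) disjoint
      ; sink∉  = trans (elem-partitioned s) sink∉
      ; covers = λ v v≢s → trans (elem-partitioned v) (covers v v≢s)
      }
      where
      open EnumeratesNonSinks enum
      disjoint : ∀ v → elem v kept ≡ true → elem v moved ≡ false
      disjoint v e with elem v moved in e′
      ... | false = refl
      ... | true  = ⊥-elim (true≢false (trans (sym (proj₁ (elem-bfilter⁻ _ v L e)))
                                              (cong not (proj₁ (elem-bfilter⁻ D v L e′)))))

    before-partitioned-across : ∀ u t → D u ≡ false → D t ≡ true → elem u L ≡ true → elem t L ≡ true →
      before partitioned u t ≡ true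
    before-partitioned-across u t Du Dt u∈L t∈L =
      before-++-across kept moved u t (elem-bfilter⁺ (not ∘ D) u L (cong not Du) u∈L) (elem-bfilter⁺ D t L Dt t∈L)

    before-partitioned : ∀ u t → (D u ≡ true → D t ≡ true) → before L u t ≡ true → before partitioned u t ≡ true
    before-partitioned u t D-closed b with D u in Du | D t in Dt
    ... | true  | true  = before-++ʳ kept moved u t (before-bfilter D u t L Du Dt b)
    ... | true  | false = ⊥-elim (true≢false (sym (D-closed refl)))
    ... | false | true  = before-partitioned-across u t Du Dt (proj₁ (before⇒elem L u t b)) (proj₂ (before⇒elem L u t b))
    ... | false | false = before-++ˡ kept moved u t (before-bfilter (not ∘ D) u t L (cong not Du) (cong not Dt) b)

-- The firing graph of a minimal recurrent configuration

module FiringGraph {n : ℕ} (G : Digraph n) (s : Fin n) (connected : Connected G) (eulerian : Eulerian G)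
                   (c : Config n) (minimal : ChipFiring.MinimalRecurrent G s c)
                   (ws : List (Fin n)) (firing : ChipFiring.FiringSeqOf G s c ws) where
  open ChipFiring G s
  open Membership G s
  open Firing G s
  open Burning G s
  open Partition G s

  F : ArcSet n
  F = firingArcs ws

  legal : Legal (c ⊕ β) ws
  legal = proj₁ firing

  returns : fireSeq (c ⊕ β) ws ≈ c
  returns = proj₂ firing

  stable : Stable c
  stable = proj₁ (proj₁ minimal)

  out-pos : ∀ v → v ≢ s → 1 ≤ outdeg G v
  out-pos v v≢s = outdeg-pos G connected eulerian v≢s

  sink∉ws : elem s ws ≡ false
  sink∉ws = Legal⇒sink∉ (c ⊕ β) ws legal

  -- a second firing of v would need all of v's in-arcs to have delivered, leaving c v ≥ outdeg v
  ws-unique : Unique ws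
  ws-unique = prefix-induction ws Unique [] step
    where
    step : ∀ P v post → P ++ v ∷ post ≡ ws → Unique P → Unique (P ++ v ∷ [])
    step P v post eq uP = Unique-snoc P v uP v∉P
      where
      split : Legal (c ⊕ β) P × Legal (fireSeq (c ⊕ β) P) (v ∷ post)
      split = Legal-++⁻ (c ⊕ β) P (v ∷ post) (subst (Legal (c ⊕ β)) (sym eq) legal)
      X : Config n
      X = fireSeq (c ⊕ β) P
      v∉P : elem v P ≡ false
      v∉P with elem v P in v∈P | proj₁ (proj₂ split)
      ... | false | _                    = refl
      ... | true  | v≢s , pos , enough = ⊥-elim (stable v (v≢s , pos , ≤-trans enough X≤c))
        where
        refired : X v + outdeg G v ≤ c v + outdeg G v
        refired = begin
          X v + outdeg G v                ≤⟨ +-monoʳ-≤ (X v) (sent-∈ v P v∈P) ⟩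
          X v + sent v P                  ≡⟨ chip-conservation (c ⊕ β) P (proj₁ split) v ⟩
          c v + β v + received v P        ≡⟨ +-assoc (c v) (β v) _ ⟩
          c v + (β v + received v P)      ≤⟨ +-monoʳ-≤ (c v) (≤-trans (β+received≤indeg v P uP s∉P) (≤-reflexive (eulerian v))) ⟩
          c v + outdeg G v                ∎
          where
          open ≤-Reasoning
          s∉P : elem s P ≡ false
          s∉P = Legal⇒sink∉ (c ⊕ β) P (proj₁ split)
        X≤c : X v ≤ c v
        X≤c = +-cancelʳ-≤ (outdeg G v) (X v) (c v) refired

  sent≡β+received : ∀ t → t ≢ s → sent t ws ≡ β t + received t ws
  sent≡β+received t t≢s = +-cancelˡ-≡ (c t) _ _
    (trans (cong (_+ sent t ws) (sym (returns t t≢s)))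
           (trans (chip-conservation (c ⊕ β) ws legal t) (+-assoc (c t) (β t) _)))

  unfired : Fin n → Bool
  unfired t = not ⌊ t ≟ s ⌋ ∧ not (elem t ws)

  unfired⁻ : ∀ t → unfired t ≡ true → t ≢ s × elem t ws ≡ false
  unfired⁻ t e with t ≟ s | elem t ws
  ... | no t≢s | false = t≢s , refl

  -- an unfired vertex received nothing, so all its in-neighbours are unfired too
  unfired-in-closed : InClosed G unfired
  unfired-in-closed t u Ut u→t with unfired⁻ t Ut
  ... | t≢s , t∉ws with u ≟ s
  ...   | yes refl = ⊥-elim (1+n≢0 (trans (cong b2n (sym u→t)) (m+n≡0⇒m≡0 (β t) nothing-received)))
    where
    nothing-received : β t + received t ws ≡ 0
    nothing-received = trans (sym (sent≡β+received t t≢s)) (sent-∉ t ws t∉ws)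
  ...   | no u≢s with elem u ws in u∈ws
  ...     | false = refl
  ...     | true  = ⊥-elim (<⇒≱ (from-u) (≤-reflexive nothing-received))
    where
    nothing-received : received t ws ≡ 0
    nothing-received = m+n≡0⇒n≡0 (β t) (trans (sym (sent≡β+received t t≢s)) (sent-∉ t ws t∉ws))
    from-u : 0 < received t ws
    from-u = begin-strict
      0                                                          <⟨ subst (λ b → 0 < b2n b) (sym u→t) ≤-refl ⟩
      arcℕ u t                                                   ≡⟨ cong (λ b → if b then arcℕ u t else 0) u∈ws ⟨
      (if elem u ws then arcℕ u t else 0)                        ≤⟨ ≤∑ (λ u → if elem u ws then arcℕ u t else 0) u ⟩
      ∑ (λ u → if elem u ws then arcℕ u t else 0)                ≡⟨ ∑-elem (λ u → arcℕ u t) ws ws-unique ⟩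
      received t ws                                              ∎
      where open ≤-Reasoning

  ws-covers : ∀ v → v ≢ s → elem v ws ≡ true
  ws-covers v v≢s with elem v ws in v∈ws
  ... | true  = refl
  ... | false = ⊥-elim (true≢false (trans (sym sink-unfired) sink-fired))
    where
    closed : ∀ x y → unfired x ≡ true → unfired y ≡ true
    closed = closed-connected G connected unfired unfired-in-closed
               (in-closed⇒out-closed G eulerian unfired unfired-in-closed)
    sink-unfired : unfired s ≡ true
    sink-unfired = closed v s (cong₂ (λ a b → not a ∧ not b) (≟-≢ v≢s) v∈ws)
    sink-fired : unfired s ≡ false
    sink-fired rewrite ≟-refl s = refl

  ws-enumerates : EnumeratesNonSinks ws
  ws-enumerates = record { unique = ws-unique ; sink∉ = sink∉ws ; covers = ws-covers }

  c-burnable : Burnable c ws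
  c-burnable v v∈ws with split-at v ws v∈ws
  ... | P , post , eq with Legal-++⁻ (c ⊕ β) P (v ∷ post) (subst (Legal (c ⊕ β)) (sym eq) legal)
  ...   | lP , (_ , _ , enough) , _ =
    subst (outdeg G v ≤_) (chips-at-turn c P v post eq ws-unique lP) enough

  burnable⇒≈c : ∀ {r L} → (∀ t → r t ≤ c t) → EnumeratesNonSinks L → Burnable r L → r ≈ c
  burnable⇒≈c {r} r≤c enum burnable =
    proj₂ minimal r (burning⇒recurrent eulerian out-pos enum r-stable burnable) (λ t _ → r≤c t)
    where
    r-stable : Stable r
    r-stable t (t≢s , pos , enough) = stable t (t≢s , pos , ≤-trans enough (r≤c t))

  -- with a chip to spare at y, c minus one chip at y still burns, so minimality forces c y = 0
  slack⇒empty : ∀ {L} → EnumeratesNonSinks L → Burnable c L →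
    ∀ y → y ≢ s → outdeg G y < c y + β y + fromEarlier L y → c y ≡ 0
  slack⇒empty {L} enum burnable y y≢s slack = chip-removed (burnable⇒≈c removed≤c enum removed-burnable y y≢s)
    where
    removed : Config n
    removed t = if ⌊ t ≟ y ⌋ then c t ∸ 1 else c t

    removed≤c : ∀ t → removed t ≤ c t
    removed≤c t with ⌊ t ≟ y ⌋
    ... | true  = m∸n≤m (c t) 1
    ... | false = ≤-refl

    spare : ∀ o a b e → suc o ≤ a + b + e → o ≤ a ∸ 1 + b + e
    spare o zero    b e le        = ≤-trans (n≤1+n o) le
    spare o (suc a) b e (s≤s le) = le

    removed-burnable : Burnable removed L
    removed-burnable t t∈L with t ≟ y
    ... | yes refl = spare (outdeg G y) (c y) (β y) (fromEarlier L y) slack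
    ... | no _     = burnable t t∈L

    chip-removed : removed y ≡ c y → c y ≡ 0
    chip-removed e rewrite ≟-refl y with c y
    ... | zero  = refl
    ... | suc k = ⊥-elim (1+n≢n (sym e))

  F⊆G : SubsetOf F G
  F⊆G x y e = proj₁ (∧-elim (arc G x y) e)

  before-from-sink : ∀ v → before ws s v ≡ false
  before-from-sink v with before ws s v in e
  ... | false = refl
  ... | true  = ⊥-elim (true≢false (trans (sym (proj₁ (before⇒elem ws s v e))) sink∉ws))

  indegF : ∀ v → v ≢ s → indegA F v ≡ β v + fromEarlier ws v
  indegF v v≢s = begin
    indegA F v                                         ≡⟨ sumV≡∑ (λ u → b2n (F u v)) ⟩
    ∑ (λ u → b2n (F u v))                              ≡⟨ sum-cong-≗ arc-kinds ⟩
    ∑ (λ u → from-sink u + from-earlier u)             ≡⟨ ∑-distrib-+ from-sink from-earlier ⟩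
    ∑ from-sink + fromEarlier ws v                     ≡⟨ cong (_+ fromEarlier ws v) (∑-pointed from-sink s off-sink) ⟩
    from-sink s + fromEarlier ws v                     ≡⟨ cong (λ b → (if b then arcℕ s v else 0) + fromEarlier ws v) (≟-refl s) ⟩
    β v + fromEarlier ws v                             ∎
    where
    open ≡-Reasoning
    from-sink from-earlier : Fin n → ℕ
    from-sink    u = if ⌊ u ≟ s ⌋ then arcℕ u v else 0
    from-earlier u = if before ws u v then arcℕ u v else 0

    arc-kinds : ∀ u → b2n (F u v) ≡ from-sink u + from-earlier u
    arc-kinds u with u ≟ s
    ... | yes refl rewrite ws-covers v v≢s | before-from-sink v = trans (cong b2n (∧-identityʳ (arc G s v))) (sym (+-identityʳ _))
    ... | no _ with before ws u v
    ...   | true  = cong b2n (∧-identityʳ (arc G u v))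
    ...   | false = cong b2n (∧-zeroʳ (arc G u v))

    off-sink : ∀ u → u ≢ s → from-sink u ≡ 0
    off-sink u u≢s rewrite ≟-≢ u≢s = refl

  indegF-sink : indegA F s ≡ 0
  indegF-sink = trans (sumV≡∑ (λ u → b2n (F u s))) (∑-zero none)
    where
    none : ∀ u → b2n (F u s) ≡ 0
    none u rewrite sink∉ws | before-∉ʳ ws u s sink∉ws | ∧-zeroʳ ⌊ u ≟ s ⌋ = cong b2n (∧-zeroʳ (arc G u s))

  indegF≤outdeg : ∀ v → indegA F v ≤ outdeg G v
  indegF≤outdeg v = ≤-trans (subset⇒indeg≤ G F⊆G v) (≤-reflexive (eulerian v))

  firing-tight : ∀ v → v ≢ s → c v + β v + fromEarlier ws v ≡ outdeg G v
  firing-tight v v≢s with c v + β v + fromEarlier ws v ≤? outdeg G v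
  ... | yes le = ≤-antisym le (c-burnable v (ws-covers v v≢s))
  ... | no  gt = ⊥-elim (<⇒≱ too-many (indegF≤outdeg v))
    where
    empty : c v ≡ 0
    empty = slack⇒empty ws-enumerates c-burnable v v≢s (≰⇒> gt)
    too-many : outdeg G v < indegA F v
    too-many = subst (outdeg G v <_) (trans (cong (λ k → k + β v + fromEarlier ws v) empty) (sym (indegF v v≢s))) (≰⇒> gt)

  chips+indegF : ∀ v → v ≢ s → c v + indegA F v ≡ outdeg G v
  chips+indegF v v≢s = trans (cong (c v +_) (indegF v v≢s)) (trans (sym (+-assoc (c v) (β v) _)) (firing-tight v v≢s))

  indegF-pos : ∀ v → v ≢ s → 0 < indegA F v
  indegF-pos v v≢s with indegA F v in e
  ... | suc _ = s≤s z≤n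
  ... | zero  = ⊥-elim (stable v (v≢s , out-pos v v≢s , ≤-reflexive full))
    where
    full : outdeg G v ≡ c v
    full = trans (sym (chips+indegF v v≢s)) (trans (cong (c v +_) e) (+-identityʳ (c v)))

  has-in-arc : ∀ v → v ≢ s → ∃ λ u → F u v ≡ true
  has-in-arc v v≢s with ∑>0⇒∃ (λ u → b2n (F u v)) (subst (0 <_) (sumV≡∑ (λ u → b2n (F u v))) (indegF-pos v v≢s))
  ... | u , pos = u , b2n-pos (F u v) pos
    where
    b2n-pos : ∀ b → 0 < b2n b → b ≡ true
    b2n-pos true _ = refl

  rank : Fin n → ℕ
  rank u = if ⌊ u ≟ s ⌋ then 0 else suc (position u ws)

  rank-bounded : ∀ v → rank v ≤ length ws
  rank-bounded v with v ≟ s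
  ... | yes _   = z≤n
  ... | no v≢s  = position<length v ws (ws-covers v v≢s)

  nonsink-head : ∀ {u v} → arc G u v ≡ true → u ≡ s → v ≢ s
  nonsink-head u→v refl refl = true≢false (trans (sym u→v) (loopless G s))

  fired-nonsink : ∀ {v} → elem v ws ≡ true → v ≢ s
  fired-nonsink v∈ws v≡s = elem-distinct ws sink∉ws v∈ws (sym v≡s)

  F-ranked : ∀ u v → F u v ≡ true → rank u < rank v
  F-ranked u v Fuv with u ≟ s | ∧-elim (arc G u v) Fuv
  ... | yes u≡s | u→v , _ rewrite ≟-≢ (nonsink-head u→v u≡s) = s≤s z≤n
  ... | no u≢s  | _   , earlier rewrite ≟-≢ (fired-nonsink (proj₂ (before⇒elem ws u v earlier))) =
    s≤s (before⇒position< ws ws-unique u v earlier)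

  open Ranked F rank F-ranked

  -- If x were not a descendant of y in F, firing the descendants of y last would put x before y,
  -- so the arc x → y would give y a spare chip; then c y = 0 and indegA F y = outdeg y, which the
  -- arc x → y outside F forbids.
  module _ {x y} (x→y : arc G x y ≡ true) (x↛y : F x y ≡ false) (x≢s : x ≢ s) (y≢s : y ≢ s) where
    open Descendants (length ws) rank-bounded y

    ws′ : List (Fin n)
    ws′ = partitioned descendant ws

    earlier-kept : ∀ t u → (if before ws u t then arcℕ u t else 0) ≤ (if before ws′ u t then arcℕ u t else 0)
    earlier-kept t u with before ws u t in u<t | arc G u t in u→t
    ... | false | _     = z≤n
    ... | true  | false = z≤n
    ... | true  | true
      rewrite before-partitioned descendant ws u t (λ Du → descendant-closed u t Du (∧-intro u→t (∨-introʳ _ u<t))) u<t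
      = ≤-refl

    ws′-burnable : Burnable c ws′
    ws′-burnable t t∈ws′ =
      ≤-trans (c-burnable t (trans (sym (elem-partitioned descendant ws t)) t∈ws′))
              (+-monoʳ-≤ (c t + β t) (∑-mono-≤ (earlier-kept t)))

    x-descendant : descendant x ≡ true
    x-descendant with descendant x in Dx
    ... | true  = refl
    ... | false = ⊥-elim (<-irrefl (trans tight-at-y (sym (eulerian y))) (subset⇒indeg< G F⊆G x→y x↛y))
      where
      not-earlier : before ws x y ≡ false
      not-earlier = trans (sym (cong₂ (λ a b → a ∧ (b ∧ elem y ws ∨ before ws x y)) x→y (≟-≢ x≢s))) x↛y
      now-earlier : before ws′ x y ≡ true
      now-earlier = before-partitioned-across descendant ws x y Dx descendant-root (ws-covers x x≢s) (ws-covers y y≢s)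
      gained : fromEarlier ws y < fromEarlier ws′ y
      gained = ∑-mono-< x (earlier-kept y)
        (subst₂ (λ a b → (if a then arcℕ x y else 0) < (if b then arcℕ x y else 0)) (sym not-earlier) (sym now-earlier)
                (subst (λ b → 0 < b2n b) (sym x→y) ≤-refl))
      empty : c y ≡ 0
      empty = slack⇒empty (partitioned-enumerates descendant ws ws-enumerates) ws′-burnable y y≢s
        (subst (_< c y + β y + fromEarlier ws′ y) (firing-tight y y≢s) (+-monoʳ-< (c y + β y) gained))
      tight-at-y : indegA F y ≡ outdeg G y
      tight-at-y = trans (sym (cong (_+ indegA F y) empty)) (chips+indegF y y≢s)

    cycle-through-nonsinks : HasCycle (addArc F x y)
    cycle-through-nonsinks with descendant⇒walk x x-descendant
    ... | inj₁ refl        = ⊥-elim (true≢false (trans (sym x→y) (loopless G x)))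
    ... | inj₂ (ys , walk) = walk⇒cycle-addArc x y ys walk

  F-from-sink : ∀ y → arc G s y ≡ true → y ≢ s → F s y ≡ true
  F-from-sink y s→y y≢s rewrite s→y | ≟-refl s | ws-covers y y≢s = refl

  maximal : ∀ x y → arc G x y ≡ true → F x y ≡ false → HasCycle (addArc F x y)
  maximal x y x→y x↛y with y ≟ s
  ... | yes refl =
    let x≢s = λ x≡s → nonsink-head x→y x≡s refl
        ys , walk = reachable-from-root s has-in-arc x x≢s
    in  walk⇒cycle-addArc x s ys walk
  ... | no y≢s = by-tail (x ≟ s)
    where
    by-tail : Dec (x ≡ s) → HasCycle (addArc F x y)
    by-tail (yes refl) = ⊥-elim (true≢false (trans (sym (F-from-sink y x→y y≢s)) x↛y))
    by-tail (no x≢s)   = cycle-through-nonsinks x→y x↛y x≢s y≢s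

  F-maximal-acyclic : MaximalAcyclicArcSet G F
  F-maximal-acyclic = (F⊆G , ranked⇒acyclic) , maximal

  indegF≡0⇒sink : ∀ v → indegA F v ≡ 0 → v ≡ s
  indegF≡0⇒sink v e with v ≟ s
  ... | yes v≡s = v≡s
  ... | no  v≢s = ⊥-elim (<⇒≢ (indegF-pos v v≢s) (sym e))

  total-chips : totalChips c + outdeg G s + sizeA F ≡ sizeA (arc G)
  total-chips = begin
    totalChips c + outdeg G s + sizeA F                               ≡⟨ cong₂ (λ a b → a + outdeg G s + b) (sumV≡∑ (except s c)) sizeF ⟩
    ∑ (except s c) + outdeg G s + ∑ (except s (indegA F))             ≡⟨ xy∙z≈xz∙y (∑ (except s c)) (outdeg G s) _ ⟩
    ∑ (except s c) + ∑ (except s (indegA F)) + outdeg G s             ≡⟨ cong (_+ outdeg G s) (∑-distrib-+ (except s c) (except s (indegA F))) ⟨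
    ∑ (λ v → except s c v + except s (indegA F) v) + outdeg G s       ≡⟨ cong (_+ outdeg G s) (sum-cong-≗ per-vertex) ⟩
    ∑ (except s (outdeg G)) + outdeg G s                              ≡⟨ +-comm _ (outdeg G s) ⟩
    outdeg G s + ∑ (except s (outdeg G))                              ≡⟨ trans (sumV≡∑ (outdeg G)) (∑-except (outdeg G) s) ⟨
    sizeA (arc G)                                                     ∎
    where
    open ≡-Reasoning
    sizeF : sizeA F ≡ ∑ (except s (indegA F))
    sizeF = trans (sizeA≡∑indegA F) (trans (∑-except (indegA F) s) (cong (_+ ∑ (except s (indegA F))) indegF-sink))
    per-vertex : ∀ v → except s c v + except s (indegA F) v ≡ except s (outdeg G) v
    per-vertex v with v ≟ s
    ... | yes _   = refl
    ... | no v≢s  = chips+indegF v v≢s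

lemma12 : ∀ {n} (G : Digraph n) (s : Fin n) → Connected G → Eulerian G →
    let open ChipFiring G s in
    ∀ (c : Config n) → MinimalRecurrent c →
    ∀ (ws : List (Fin n)) → FiringSeqOf c ws →
    let F = firingArcs ws in
    (∀ v → v ≢ s → c v + indegA F v ≡ outdeg G v)
    × MaximalAcyclicArcSet G F
    × indegA F s ≡ 0
    × (∀ v → indegA F v ≡ 0 → v ≡ s)
    × totalChips c + outdeg G s + sizeA F ≡ sizeA (arc G)
lemma12 G s connected eulerian c minimal ws firing =
    chips+indegF
  , F-maximal-acyclic
  , indegF-sink
  , indegF≡0⇒sink
  , total-chips
  where open FiringGraph G s connected eulerian c minimal ws firing
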